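{- For every formula $\phi$ and variable $x$, $\mathbf{S4.2}^{[\mathsf{K}^\mathtt{MS}]}\vdash[\mathsf{K}^\mathtt{MS}]^x\phi\to[\mathsf{K}][\mathsf{K}^\mathtt{MS}]^x\phi$. On the other hand, for each $[\mathsf{K}_\mathtt{wh}]\in\{[\mathsf{tB}^\mathtt{MS}],[\mathsf{tB}^\mathtt{MS}_\mathtt{FS}],[\mathsf{K}^\mathtt{MS}_\mathtt{FS}]\}$, the schema $[\mathsf{K}_\mathtt{wh}]^x\phi\to[\mathsf{K}][\mathsf{K}_\mathtt{wh}]^x\phi$ is not derivable in $\mathbf{S4.2}^{[\mathsf{K}_\mathtt{wh}]}$: there exist a formula $\phi$ and a variable $x$ such that $\mathbf{S4.2}^{[\mathsf{K}_\mathtt{wh}]}\nvdash[\mathsf{K}_\mathtt{wh}]^x\phi\to[\mathsf{K}][\mathsf{K}_\mathtt{wh}]^x\phi$.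
   Context: Fix a set $\mathcal{P}$ of predicate symbols with arities and a countably infinite set $\mathbf{X}$ of variables. For $[\mathsf{K}_\mathtt{wh}]\in\{[\mathsf{tB}^\mathtt{MS}],[\mathsf{tB}^\mathtt{MS}_\mathtt{FS}],[\mathsf{K}^\mathtt{MS}],[\mathsf{K}^\mathtt{MS}_\mathtt{FS}]\}$, the language $\mathcal{L}([\mathsf{K}_\mathtt{wh}])$ is $\phi ::= P(y_1,\dots,y_n)\mid\neg\phi\mid\phi\wedge\phi\mid[\mathsf{K}]\phi\mid[\mathsf{K}_\mathtt{wh}]^x\phi$, where $[\mathsf{K}_\mathtt{wh}]^x$ binds $x$. Abbreviations: $\langle\mathsf{K}\rangle\phi:=\neg[\mathsf{K}]\neg\phi$, $[\mathsf{B}]\phi:=\langle\mathsf{K}\rangle[\mathsf{K}]\phi$. $FV(\phi)$ denotes free variables; $\phi[y/x]$ replaces free $x$ by $y$, assuming $y$ admissible (not captured by a $[\mathsf{K}_\mathtt{wh}]^y$). Proof systems. $\mathbf{S4.2}^{[\mathsf{K}]}$: all instances of propositional tautologies and of $[\mathsf{K}](\phi\to\psi)\to([\mathsf{K}]\phi\to[\mathsf{K}]\psi)$, $[\mathsf{K}]\phi\to\phi$, $[\mathsf{K}]\phi\to[\mathsf{K}][\mathsf{K}]\phi$, $\langle\mathsf{K}\rangle[\mathsf{K}]\phi\to[\mathsf{K}]\langle\mathsf{K}\rangle\phi$, with modus ponens and necessitation for $[\mathsf{K}]$. Axiom schemas: $\mathtt{TBtoK_{wh}}$: $([\mathsf{B}]\phi\wedge\phi)[y/x]\to[\mathsf{K}_\mathtt{wh}]^x\phi$;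 $\mathtt{KtoK_{wh}}$: $[\mathsf{K}]\phi[y/x]\to[\mathsf{K}_\mathtt{wh}]^x\phi$; $\mathtt{K_{wh}toFS}$: $[\mathsf{K}_\mathtt{wh}]^x\phi\to([\mathsf{B}]\phi\to\phi)[y/x]$; $\mathtt{BtoBK_{wh}}$: $[\mathsf{B}]\phi[y/x]\to[\mathsf{B}][\mathsf{K}_\mathtt{wh}]^x\phi$. Rules (any $n\ge0$, formulas $\psi_0..\psi_n$ with $x\notin\bigcup_i FV(\psi_i)$; $C[\chi]$ denotes $\psi_0\to[\mathsf{K}](\psi_1\to\cdots[\mathsf{K}](\psi_n\to\chi)\cdots)$): $\mathtt{K_{wh}toTB}$: from $\vdash C[\neg([\mathsf{B}]\phi\wedge\phi)]$ infer $\vdash C[\neg[\mathsf{K}_\mathtt{wh}]^x\phi]$; $\mathtt{K_{wh}toK}$: from $\vdash C[\neg[\mathsf{K}]\phi]$ infer $\vdash C[\neg[\mathsf{K}_\mathtt{wh}]^x\phi]$; $\mathtt{FS\&BtoK_{wh}}$: from $\vdash C[[\mathsf{B}]\phi\to\phi]$ infer $\vdash C[[\mathsf{B}]\phi[y/x]\to[\mathsf{K}_\mathtt{wh}]^x\phi]$; $\mathtt{FS\&KtoK_{wh}}$: from $\vdash C[[\mathsf{B}]\phi\to\phi]$ infer $\vdash C[[\mathsf{K}]\phi[y/x]\to[\mathsf{K}_\mathtt{wh}]^x\phi]$. Logics (least sets closed under listed axioms/rules): $\mathbf{S4.2}^{[\mathsf{tB}^\mathtt{MS}]}=\mathbf{S4.2}^{[\mathsf{K}]}+\mathtt{TBtoK_{wh}},\mathtt{K_{wh}toTB}$;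 $\mathbf{S4.2}^{[\mathsf{tB}^\mathtt{MS}_\mathtt{FS}]}=\mathbf{S4.2}^{[\mathsf{K}]}+\mathtt{K_{wh}toFS},\mathtt{BtoBK_{wh}},\mathtt{K_{wh}toTB},\mathtt{FS\&BtoK_{wh}}$; $\mathbf{S4.2}^{[\mathsf{K}^\mathtt{MS}]}=\mathbf{S4.2}^{[\mathsf{K}]}+\mathtt{KtoK_{wh}},\mathtt{K_{wh}toK}$; $\mathbf{S4.2}^{[\mathsf{K}^\mathtt{MS}_\mathtt{FS}]}=\mathbf{S4.2}^{[\mathsf{K}]}+\mathtt{K_{wh}toFS},\mathtt{BtoBK_{wh}},\mathtt{K_{wh}toK},\mathtt{FS\&KtoK_{wh}}$. -}

module Defs where

open import Data.Nat using (ℕ; _≟_)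
open import Data.Bool using (Bool; true; false; not; _∧_; if_then_else_)
open import Data.Vec using (Vec; map)
open import Data.Vec.Membership.Propositional using (_∈_)
open import Data.List using (List; []; _∷_)
open import Data.List.Relation.Unary.All using (All)
open import Data.Product using (_×_)
open import Data.Sum using (_⊎_)
open import Relation.Nullary using (¬_; yes; no)
open import Relation.Binary.PropositionalEquality using (_≡_; _≢_)

record Signature : Set₁ where
  field
    Pred  : Set
    arity : Pred → ℕ
open Signature public

Var : Set
Var = ℕ

-- The language ℒ([K_wh]).  The single operator  Kwh x φ  stands for
-- [K_wh]^x φ (binding x); which of the four readings it has is
-- determined by the logic (Variant) in which we derive.

data Fm (S : Signature) : Set where
  atom : (P : Pred S) → Vec Var (arity S P) → Fm S
  ~_   : Fm S → Fm S
  _&_  : Fm S → Fm S → Fm S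
  K    : Fm S → Fm S
  Kwh  : Var → Fm S → Fm S

infix  9 ~_
infixr 7 _&_

module _ {S : Signature} where

  infixr 5 _⇒_

  _⇒_ : Fm S → Fm S → Fm S
  φ ⇒ ψ = ~ (φ & ~ ψ)

  ⟨K⟩ : Fm S → Fm S
  ⟨K⟩ φ = ~ K (~ φ)

  B : Fm S → Fm S
  B φ = ⟨K⟩ (K φ)

  data Free (x : Var) : Fm S → Set where
    free-atom : ∀ {P ys} → x ∈ ys → Free x (atom P ys)
    free-~    : ∀ {φ} → Free x φ → Free x (~ φ)
    free-&ˡ   : ∀ {φ ψ} → Free x φ → Free x (φ & ψ)
    free-&ʳ   : ∀ {φ ψ} → Free x ψ → Free x (φ & ψ)
    free-K    : ∀ {φ} → Free x φ → Free x (K φ)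
    free-Kwh  : ∀ {z φ} → z ≢ x → Free x φ → Free x (Kwh z φ)

  -- substitution  sub y x φ  =  φ[y/x]  (replace free occurrences of x by y)
  rename : Var → Var → Var → Var
  rename y x z with z ≟ x
  ... | yes _ = y
  ... | no  _ = z

  sub : Var → Var → Fm S → Fm S
  sub y x (atom P ys) = atom P (map (rename y x) ys)
  sub y x (~ φ)       = ~ sub y x φ
  sub y x (φ & ψ)     = sub y x φ & sub y x ψ
  sub y x (K φ)       = K (sub y x φ)
  sub y x (Kwh z φ) with z ≟ x
  ... | yes _ = Kwh z φ
  ... | no  _ = Kwh z (sub y x φ)

  data FreeFor (y x : Var) : Fm S → Set where
    ff-atom : ∀ {P ys} → FreeFor y x (atom P ys)
    ff-~    : ∀ {φ} → FreeFor y x φ → FreeFor y x (~ φ)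
    ff-&    : ∀ {φ ψ} → FreeFor y x φ → FreeFor y x ψ → FreeFor y x (φ & ψ)
    ff-K    : ∀ {φ} → FreeFor y x φ → FreeFor y x (K φ)
    ff-Kwh-nofree : ∀ {z φ} → ¬ Free x (Kwh z φ) → FreeFor y x (Kwh z φ)
    ff-Kwh  : ∀ {z φ} → z ≢ y → FreeFor y x φ → FreeFor y x (Kwh z φ)

  -- propositional tautologies: formulas true under every Boolean
  -- valuation of their propositionally-atomic subformulas
  -- (atoms, [K]-formulas and [K_wh]-formulas)
  evalB : (Fm S → Bool) → Fm S → Bool
  evalB v (~ φ)   = not (evalB v φ)
  evalB v (φ & ψ) = evalB v φ ∧ evalB v ψ
  evalB v φ       = v φ

  Tautology : Fm S → Set
  Tautology φ = ∀ (v : Fm S → Bool) → evalB v φ ≡ true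

  nest : List (Fm S) → Fm S → Fm S
  nest []       χ = χ
  nest (ψ ∷ ψs) χ = K (ψ ⇒ nest ψs χ)

  Ctx : Fm S → List (Fm S) → Fm S → Fm S
  Ctx ψ₀ ψs χ = ψ₀ ⇒ nest ψs χ

  CtxFresh : Var → Fm S → List (Fm S) → Set
  CtxFresh x ψ₀ ψs = ¬ Free x ψ₀ × All (λ ψ → ¬ Free x ψ) ψs

data Variant : Set where
  tB-MS tB-MS-FS K-MS K-MS-FS : Variant

data HasTB : Variant → Set where
  tb₁ : HasTB tB-MS
  tb₂ : HasTB tB-MS-FS

data HasFS : Variant → Set where
  fs₁ : HasFS tB-MS-FS
  fs₂ : HasFS K-MS-FS

data HasK : Variant → Set where
  k₁ : HasK K-MS
  k₂ : HasK K-MS-FS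

data _⊢_ {S : Signature} : Variant → Fm S → Set where
  taut : ∀ {L φ} → Tautology φ → L ⊢ φ
  axK  : ∀ {L φ ψ} → L ⊢ (K (φ ⇒ ψ) ⇒ (K φ ⇒ K ψ))
  axT  : ∀ {L φ} → L ⊢ (K φ ⇒ φ)
  ax4  : ∀ {L φ} → L ⊢ (K φ ⇒ K (K φ))
  ax2  : ∀ {L φ} → L ⊢ (⟨K⟩ (K φ) ⇒ K (⟨K⟩ φ))
  mp   : ∀ {L φ ψ} → L ⊢ (φ ⇒ ψ) → L ⊢ φ → L ⊢ ψ
  nec  : ∀ {L φ} → L ⊢ φ → L ⊢ K φ
  TBtoKwh : ∀ {φ x y} → FreeFor y x (B φ & φ) →
            tB-MS ⊢ (sub y x (B φ & φ) ⇒ Kwh x φ)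
  KtoKwh  : ∀ {φ x y} → FreeFor y x φ →
            K-MS ⊢ (K (sub y x φ) ⇒ Kwh x φ)
  KwhtoFS : ∀ {L φ x y} → HasFS L → FreeFor y x (B φ ⇒ φ) →
            L ⊢ (Kwh x φ ⇒ sub y x (B φ ⇒ φ))
  BtoBKwh : ∀ {L φ x y} → HasFS L → FreeFor y x φ →
            L ⊢ (B (sub y x φ) ⇒ B (Kwh x φ))
  KwhtoTB : ∀ {L φ x ψ₀ ψs} → HasTB L → CtxFresh x ψ₀ ψs →
            L ⊢ Ctx ψ₀ ψs (~ (B φ & φ)) → L ⊢ Ctx ψ₀ ψs (~ Kwh x φ)
  KwhtoK  : ∀ {L φ x ψ₀ ψs} → HasK L → CtxFresh x ψ₀ ψs →
            L ⊢ Ctx ψ₀ ψs (~ K φ) → L ⊢ Ctx ψ₀ ψs (~ Kwh x φ)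
  FSBtoKwh : ∀ {φ x y ψ₀ ψs} → CtxFresh x ψ₀ ψs → FreeFor y x φ →
             tB-MS-FS ⊢ Ctx ψ₀ ψs (B φ ⇒ φ) →
             tB-MS-FS ⊢ Ctx ψ₀ ψs (B (sub y x φ) ⇒ Kwh x φ)
  FSKtoKwh : ∀ {φ x y ψ₀ ψs} → CtxFresh x ψ₀ ψs → FreeFor y x φ →
             K-MS-FS ⊢ Ctx ψ₀ ψs (B φ ⇒ φ) →
             K-MS-FS ⊢ Ctx ψ₀ ψs (K (sub y x φ) ⇒ Kwh x φ)

infix 2 _⊢_

-- In S4.2^[K^MS] the axiom KtoK_wh gives K φ → Kwh x φ, hence K φ → K (Kwh x φ)
-- by 4; the rule K_wh toK with context ¬ K (Kwh x φ) turns the contrapositive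
-- into ¬ K (Kwh x φ) → ¬ Kwh x φ.
--
-- For the other three logics we give a model in which every theorem holds but
-- Kwh x P(x) → K (Kwh x P(x)) fails.  The frame is the chain w₀ ≤ w₁ ≤ w₂, whose
-- top world w₂ makes [B] φ equivalent to φ at w₂; the domain is Bool, and
-- [K_wh]^x φ is read "for some value d of x, [B] φ ∧ φ (resp. [K] φ) holds",
-- conjoined in the FS variants with "for every d, [B] φ → φ".  Interpreting P so
-- that it fails at w₁ (for d = false in the K-variant) makes Kwh x P(x) true at
-- w₀ but false at w₁.

module Submission where

open import Defs
open import Data.Nat using (_≤_; s≤s) renaming (_≟_ to _≟ℕ_)
open import Data.Bool using (Bool; true; false; not; _∧_; _∨_; T)
open import Data.Bool.Properties using (T-∧; T-∨; T-≡)
open import Data.Product using (_×_; ∃; ∃₂; _,_; proj₁; proj₂)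
open import Data.Sum using (inj₁; inj₂; [_,_])
open import Data.Empty using (⊥-elim)
open import Data.Unit using (tt)
open import Data.Vec using (Vec; []; _∷_; map; replicate)
open import Data.Vec.Properties using (map-cong; map-id; map-∘)
open import Data.Vec.Relation.Unary.Any using (here; there)
open import Data.Vec.Membership.Propositional using () renaming (_∈_ to _∈ᵥ_)
open import Data.List using ([]; _∷_)
open import Data.List.Relation.Unary.All using (All; []; _∷_)
open import Function using (_∘_)
open import Function.Bundles using (Equivalence)
open import Relation.Nullary using (¬_; yes; no)
open import Relation.Nullary.Decidable using (T?; decidable-stable)
open import Relation.Binary.PropositionalEquality
  using (_≡_; _≢_; refl; sym; trans; cong; cong₂; subst)

open Equivalence using (to; from)

module _ {S : Signature} where

  sub-refl : ∀ x (φ : Fm S) → sub x x φ ≡ φ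
  sub-refl x (atom P ys) = cong (atom P) (trans (map-cong rename-refl ys) (map-id ys))
    where
    rename-refl : ∀ z → rename {S = S} x x z ≡ z
    rename-refl z with z ≟ℕ x
    ... | yes z≡x = sym z≡x
    ... | no  _   = refl
  sub-refl x (~ φ)     = cong ~_ (sub-refl x φ)
  sub-refl x (φ & ψ)   = cong₂ _&_ (sub-refl x φ) (sub-refl x ψ)
  sub-refl x (K φ)     = cong K (sub-refl x φ)
  sub-refl x (Kwh z φ) with z ≟ℕ x
  ... | yes _ = refl
  ... | no  _ = cong (Kwh z) (sub-refl x φ)

  ff-B : ∀ {y x} {φ : Fm S} → FreeFor y x φ → FreeFor y x (B φ)
  ff-B ff = ff-~ (ff-K (ff-~ (ff-K ff)))

  freeFor-refl : ∀ x (φ : Fm S) → FreeFor x x φ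
  freeFor-refl x (atom P ys) = ff-atom
  freeFor-refl x (~ φ)       = ff-~ (freeFor-refl x φ)
  freeFor-refl x (φ & ψ)     = ff-& (freeFor-refl x φ) (freeFor-refl x ψ)
  freeFor-refl x (K φ)       = ff-K (freeFor-refl x φ)
  freeFor-refl x (Kwh z φ) with z ≟ℕ x
  ... | yes refl = ff-Kwh-nofree λ { (free-Kwh z≢z _) → z≢z refl }
  ... | no  z≢x  = ff-Kwh z≢x (freeFor-refl x φ)

  sub-fresh : ∀ {y x} (φ : Fm S) → ¬ Free x φ → sub y x φ ≡ φ
  sub-fresh {y} {x} (atom P ys) x∉φ = cong (atom P) (map-rename-fresh ys (x∉φ ∘ free-atom))
    where
    map-rename-fresh : ∀ {n} (zs : Vec Var n) → ¬ x ∈ᵥ zs → map (rename {S = S} y x) zs ≡ zs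
    map-rename-fresh []       _   = refl
    map-rename-fresh (z ∷ zs) x∉zs with z ≟ℕ x
    ... | yes z≡x = ⊥-elim (x∉zs (here (sym z≡x)))
    ... | no  _   = cong (z ∷_) (map-rename-fresh zs (x∉zs ∘ there))
  sub-fresh (~ φ)   x∉φ = cong ~_ (sub-fresh φ (x∉φ ∘ free-~))
  sub-fresh (φ & ψ) x∉φ = cong₂ _&_ (sub-fresh φ (x∉φ ∘ free-&ˡ)) (sub-fresh ψ (x∉φ ∘ free-&ʳ))
  sub-fresh (K φ)   x∉φ = cong K (sub-fresh φ (x∉φ ∘ free-K))
  sub-fresh {x = x} (Kwh z φ) x∉φ with z ≟ℕ x
  ... | yes _   = refl
  ... | no  z≢x = cong (Kwh z) (sub-fresh φ (x∉φ ∘ free-Kwh z≢x))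

infixr 5 _⇒ᵇ_

_⇒ᵇ_ : Bool → Bool → Bool
a ⇒ᵇ b = not (a ∧ not b)

T-not⁺ : ∀ {a} → ¬ T a → T (not a)
T-not⁺ {false} _ = tt
T-not⁺ {true} ¬a = ¬a tt

T-not⁻ : ∀ {a} → T (not a) → ¬ T a
T-not⁻ {false} _ ()

T-⇒ᵇ⁺ : ∀ {a b} → (T a → T b) → T (a ⇒ᵇ b)
T-⇒ᵇ⁺ {false} _ = tt
T-⇒ᵇ⁺ {true} {true} _ = tt
T-⇒ᵇ⁺ {true} {false} a→b = a→b tt

T-⇒ᵇ⁻ : ∀ {a b} → T (a ⇒ᵇ b) → T a → T b
T-⇒ᵇ⁻ {true} {true} _ _ = tt

∃ᵇ ∀ᵇ : (Bool → Bool) → Bool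
∃ᵇ f = f true ∨ f false
∀ᵇ f = f true ∧ f false

∃ᵇ-intro : ∀ {f} d → T (f d) → T (∃ᵇ f)
∃ᵇ-intro true  h = from T-∨ (inj₁ h)
∃ᵇ-intro {f} false h = from (T-∨ {f true}) (inj₂ h)

∃ᵇ-elim : ∀ {f} → T (∃ᵇ f) → ∃ λ d → T (f d)
∃ᵇ-elim {f} h = [ (true ,_) , (false ,_) ] (to (T-∨ {f true}) h)

∀ᵇ-intro : ∀ {f} → (∀ d → T (f d)) → T (∀ᵇ f)
∀ᵇ-intro h = from T-∧ (h true , h false)

∀ᵇ-elim : ∀ {f} → T (∀ᵇ f) → ∀ d → T (f d)
∀ᵇ-elim {f} h true  = proj₁ (to (T-∧ {f true}) h)
∀ᵇ-elim {f} h false = proj₂ (to (T-∧ {f true}) h)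

-- The frame: a three-element chain

data World : Set where
  w₀ w₁ w₂ : World

infix 4 _≼_

data _≼_ : World → World → Set where
  ≼-refl : ∀ {w} → w ≼ w
  w₀≼w₁  : w₀ ≼ w₁
  w₀≼w₂  : w₀ ≼ w₂
  w₁≼w₂  : w₁ ≼ w₂

≼-trans : ∀ {u v w} → u ≼ v → v ≼ w → u ≼ w
≼-trans ≼-refl q      = q
≼-trans p      ≼-refl = p
≼-trans w₀≼w₁  w₁≼w₂  = w₀≼w₂

≼-top : ∀ w → w ≼ w₂
≼-top w₀ = w₀≼w₂
≼-top w₁ = w₁≼w₂
≼-top w₂ = ≼-refl

opaque
  □ : (World → Bool) → World → Bool
  □ f w₀ = f w₀ ∧ f w₁ ∧ f w₂
  □ f w₁ = f w₁ ∧ f w₂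
  □ f w₂ = f w₂

◇ : (World → Bool) → World → Bool
◇ f w = not (□ (not ∘ f) w)

opaque
  unfolding □

  □-intro : ∀ {f w} → (∀ {v} → w ≼ v → T (f v)) → T (□ f w)
  □-intro {w = w₀} h = from T-∧ (h ≼-refl , from T-∧ (h w₀≼w₁ , h w₀≼w₂))
  □-intro {w = w₁} h = from T-∧ (h ≼-refl , h w₁≼w₂)
  □-intro {w = w₂} h = h ≼-refl

  □-elim : ∀ {f w v} → T (□ f w) → w ≼ v → T (f v)
  □-elim {f} {w₀} h ≼-refl = proj₁ (to (T-∧ {f w₀}) h)
  □-elim {f} {w₀} h w₀≼w₁  = proj₁ (to (T-∧ {f w₁}) (proj₂ (to (T-∧ {f w₀}) h)))
  □-elim {f} {w₀} h w₀≼w₂  = proj₂ (to (T-∧ {f w₁}) (proj₂ (to (T-∧ {f w₀}) h)))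
  □-elim {f} {w₁} h ≼-refl = proj₁ (to (T-∧ {f w₁}) h)
  □-elim {f} {w₁} h w₁≼w₂  = proj₂ (to (T-∧ {f w₁}) h)
  □-elim {w = w₂} h ≼-refl = h

  □-cong : ∀ {f g} → (∀ v → f v ≡ g v) → ∀ w → □ f w ≡ □ g w
  □-cong p w₀ = cong₂ _∧_ (p w₀) (cong₂ _∧_ (p w₁) (p w₂))
  □-cong p w₁ = cong₂ _∧_ (p w₁) (p w₂)
  □-cong p w₂ = p w₂

◇-intro : ∀ {f w v} → w ≼ v → T (f v) → T (◇ f w)
◇-intro w≼v fv = T-not⁺ λ □¬f → T-not⁻ (□-elim □¬f w≼v) fv

◇□-elim : ∀ {f w} → T (◇ (□ f) w) → T (f w₂)
◇□-elim {f} h = decidable-stable (T? (f w₂)) λ ¬top →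
  T-not⁻ h (□-intro λ {v} _ → T-not⁺ λ □f → ¬top (□-elim □f (≼-top v)))

◇□-intro : ∀ {f w} → T (f w₂) → T (◇ (□ f) w)
◇□-intro {f} {w} h = ◇-intro (≼-top w) (□-intro {f} λ { ≼-refl → h })

◇□-cong : ∀ {f g} → (∀ v → f v ≡ g v) → ∀ w → ◇ (□ f) w ≡ ◇ (□ g) w
◇□-cong p w = cong not (□-cong (λ v → cong not (□-cong p v)) w)

-- F d w is the truth value at w of a formula whose variable x has value d.
Extension : Set
Extension = Bool → World → Bool

opaque
  tB-some K-some FS-all : Extension → World → Bool
  tB-some F w = ∃ᵇ λ d → ◇ (□ (F d)) w ∧ F d w
  K-some  F w = ∃ᵇ λ d → □ (F d) w
  FS-all  F w = ∀ᵇ λ d → ◇ (□ (F d)) w ⇒ᵇ F d w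

⟦Kwh⟧ : Variant → Extension → World → Bool
⟦Kwh⟧ tB-MS    F w = tB-some F w
⟦Kwh⟧ tB-MS-FS F w = tB-some F w ∧ FS-all F w
⟦Kwh⟧ K-MS     F w = K-some F w
⟦Kwh⟧ K-MS-FS  F w = K-some F w ∧ FS-all F w

opaque
  unfolding tB-some K-some FS-all

  tB-some-intro : ∀ {F w} d → T (◇ (□ (F d)) w) → T (F d w) → T (tB-some F w)
  tB-some-intro {F} {w} d Bφ φ = ∃ᵇ-intro {λ d → ◇ (□ (F d)) w ∧ F d w} d (from T-∧ (Bφ , φ))

  tB-some-elim : ∀ {F w} → T (tB-some F w) → ∃ λ d → T (◇ (□ (F d)) w) × T (F d w)
  tB-some-elim {F} {w} h with ∃ᵇ-elim {λ d → ◇ (□ (F d)) w ∧ F d w} h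
  ... | d , Bh = d , to (T-∧ {◇ (□ (F d)) w}) Bh

  K-some-intro : ∀ {F w} d → T (□ (F d) w) → T (K-some F w)
  K-some-intro {F} {w} = ∃ᵇ-intro {λ d → □ (F d) w}

  K-some-elim : ∀ {F w} → T (K-some F w) → ∃ λ d → T (□ (F d) w)
  K-some-elim {F} {w} = ∃ᵇ-elim {λ d → □ (F d) w}

  FS-all-intro : ∀ {F w} → (∀ d → T (◇ (□ (F d)) w) → T (F d w)) → T (FS-all F w)
  FS-all-intro {F} {w} h = ∀ᵇ-intro {λ d → ◇ (□ (F d)) w ⇒ᵇ F d w} λ d → T-⇒ᵇ⁺ (h d)

  FS-all-elim : ∀ {F w} → T (FS-all F w) → ∀ d → T (◇ (□ (F d)) w) → T (F d w)
  FS-all-elim {F} {w} h d = T-⇒ᵇ⁻ (∀ᵇ-elim {λ d → ◇ (□ (F d)) w ⇒ᵇ F d w} h d)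

  tB-some-cong : ∀ {F G} → (∀ d v → F d v ≡ G d v) → ∀ w → tB-some F w ≡ tB-some G w
  tB-some-cong p w =
    cong₂ _∨_ (cong₂ _∧_ (◇□-cong (p true) w) (p true w))
              (cong₂ _∧_ (◇□-cong (p false) w) (p false w))

  K-some-cong : ∀ {F G} → (∀ d v → F d v ≡ G d v) → ∀ w → K-some F w ≡ K-some G w
  K-some-cong p w = cong₂ _∨_ (□-cong (p true) w) (□-cong (p false) w)

  FS-all-cong : ∀ {F G} → (∀ d v → F d v ≡ G d v) → ∀ w → FS-all F w ≡ FS-all G w
  FS-all-cong p w =
    cong₂ _∧_ (cong₂ _⇒ᵇ_ (◇□-cong (p true) w) (p true w))
              (cong₂ _⇒ᵇ_ (◇□-cong (p false) w) (p false w))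

⟦Kwh⟧-cong : ∀ L {F G} → (∀ d v → F d v ≡ G d v) → ∀ w → ⟦Kwh⟧ L F w ≡ ⟦Kwh⟧ L G w
⟦Kwh⟧-cong tB-MS    p w = tB-some-cong p w
⟦Kwh⟧-cong tB-MS-FS p w = cong₂ _∧_ (tB-some-cong p w) (FS-all-cong p w)
⟦Kwh⟧-cong K-MS     p w = K-some-cong p w
⟦Kwh⟧-cong K-MS-FS  p w = cong₂ _∧_ (K-some-cong p w) (FS-all-cong p w)

⟦Kwh⟧-tB : ∀ {L F w} → HasTB L → T (⟦Kwh⟧ L F w) → ∃ λ d → T (◇ (□ (F d)) w) × T (F d w)
⟦Kwh⟧-tB tb₁ h = tB-some-elim h
⟦Kwh⟧-tB tb₂ h = tB-some-elim (proj₁ (to T-∧ h))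

⟦Kwh⟧-K : ∀ {L F w} → HasK L → T (⟦Kwh⟧ L F w) → ∃ λ d → T (□ (F d) w)
⟦Kwh⟧-K k₁ h = K-some-elim h
⟦Kwh⟧-K k₂ h = K-some-elim (proj₁ (to T-∧ h))

⟦Kwh⟧-FS : ∀ {L F w} → HasFS L → T (⟦Kwh⟧ L F w) → ∀ d → T (◇ (□ (F d)) w) → T (F d w)
⟦Kwh⟧-FS fs₁ h = FS-all-elim (proj₂ (to T-∧ h))
⟦Kwh⟧-FS fs₂ h = FS-all-elim (proj₂ (to T-∧ h))

⟦Kwh⟧-FS&B : ∀ {F w} d → T (◇ (□ (F d)) w) → (∀ d → T (◇ (□ (F d)) w) → T (F d w)) →
             T (⟦Kwh⟧ tB-MS-FS F w)
⟦Kwh⟧-FS&B d Bφ FS = from T-∧ (tB-some-intro d Bφ (FS d Bφ) , FS-all-intro FS)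

⟦Kwh⟧-FS&K : ∀ {F w} d → T (□ (F d) w) → (∀ d → T (◇ (□ (F d)) w) → T (F d w)) →
             T (⟦Kwh⟧ K-MS-FS F w)
⟦Kwh⟧-FS&K d Kφ FS = from T-∧ (K-some-intro d Kφ , FS-all-intro FS)

-- At the top world [B] φ is just φ, so the FS condition holds trivially there.
⟦Kwh⟧-top : ∀ {L F} d → HasFS L → T (F d w₂) → T (⟦Kwh⟧ L F w₂)
⟦Kwh⟧-top d fs₁ h = ⟦Kwh⟧-FS&B d (◇□-intro h) λ _ → ◇□-elim
⟦Kwh⟧-top d fs₂ h = ⟦Kwh⟧-FS&K d (□-intro λ { ≼-refl → h }) λ _ → ◇□-elim

Interpretation : Signature → Set
Interpretation S = (P : Pred S) → World → Vec Bool (arity S P) → Bool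

Assignment : Set
Assignment = Var → Bool

_[_≔_] : {A : Set} → (Var → A) → Var → A → Var → A
(g [ x ≔ a ]) z with z ≟ℕ x
... | yes _ = a
... | no  _ = g z

≔-same : ∀ {A : Set} (g : Var → A) x a → (g [ x ≔ a ]) x ≡ a
≔-same g x a with x ≟ℕ x
... | yes _   = refl
... | no  x≢x = ⊥-elim (x≢x refl)

≔-other : ∀ {A : Set} (g : Var → A) {x z} a → z ≢ x → (g [ x ≔ a ]) z ≡ g z
≔-other g {x} {z} a z≢x with z ≟ℕ x
... | yes z≡x = ⊥-elim (z≢x z≡x)
... | no  _   = refl

≔-comm : ∀ {A : Set} (g : Var → A) {x z} a b → x ≢ z →
         ∀ u → ((g [ z ≔ b ]) [ x ≔ a ]) u ≡ ((g [ x ≔ a ]) [ z ≔ b ]) u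
≔-comm g {x} {z} a b x≢z u with u ≟ℕ x | u ≟ℕ z
... | yes refl | yes refl = ⊥-elim (x≢z refl)
... | yes refl | no  _    = sym (≔-same g u a)
... | no  _    | yes refl = ≔-same g u b
... | no  u≢x  | no  u≢z  = trans (≔-other g b u≢z) (sym (≔-other g a u≢x))

module Semantics {S : Signature} (L : Variant) (I : Interpretation S) where

  ⟦_⟧ : Fm S → World → Assignment → Bool
  ⟦ atom P ys ⟧ w g = I P w (map g ys)
  ⟦ ~ φ ⟧       w g = not (⟦ φ ⟧ w g)
  ⟦ φ & ψ ⟧     w g = ⟦ φ ⟧ w g ∧ ⟦ ψ ⟧ w g
  ⟦ K φ ⟧       w g = □ (λ v → ⟦ φ ⟧ v g) w
  ⟦ Kwh x φ ⟧   w g = ⟦Kwh⟧ L (λ d v → ⟦ φ ⟧ v (g [ x ≔ d ])) w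

  ⊨_ : Fm S → Set
  ⊨ φ = ∀ w g → T (⟦ φ ⟧ w g)

  rename-≔ : ∀ (g : Assignment) y x z → g (rename {S = S} y x z) ≡ (g [ x ≔ g y ]) z
  rename-≔ g y x z with z ≟ℕ x
  ... | yes _ = refl
  ... | no  _ = refl

  ⟦⟧-evalB : ∀ φ w g → evalB (λ ψ → ⟦ ψ ⟧ w g) φ ≡ ⟦ φ ⟧ w g
  ⟦⟧-evalB (atom P ys) w g = refl
  ⟦⟧-evalB (~ φ)       w g = cong not (⟦⟧-evalB φ w g)
  ⟦⟧-evalB (φ & ψ)     w g = cong₂ _∧_ (⟦⟧-evalB φ w g) (⟦⟧-evalB ψ w g)
  ⟦⟧-evalB (K φ)       w g = refl
  ⟦⟧-evalB (Kwh x φ)   w g = refl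

  ⟦⟧-coincide : ∀ φ {g h} → (∀ u → Free u φ → g u ≡ h u) → ∀ w → ⟦ φ ⟧ w g ≡ ⟦ φ ⟧ w h
  ⟦⟧-coincide (atom P ys) {g} {h} g≗h w = cong (I P w) (map-agree ys (λ u → g≗h u ∘ free-atom))
    where
    map-agree : ∀ {n} (zs : Vec Var n) → (∀ u → u ∈ᵥ zs → g u ≡ h u) → map g zs ≡ map h zs
    map-agree []       _ = refl
    map-agree (z ∷ zs) p = cong₂ _∷_ (p z (here refl)) (map-agree zs (λ u → p u ∘ there))
  ⟦⟧-coincide (~ φ)   g≗h w = cong not (⟦⟧-coincide φ (λ u → g≗h u ∘ free-~) w)
  ⟦⟧-coincide (φ & ψ) g≗h w =
    cong₂ _∧_ (⟦⟧-coincide φ (λ u → g≗h u ∘ free-&ˡ) w) (⟦⟧-coincide ψ (λ u → g≗h u ∘ free-&ʳ) w)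
  ⟦⟧-coincide (K φ)   g≗h w = □-cong (⟦⟧-coincide φ (λ u → g≗h u ∘ free-K)) w
  ⟦⟧-coincide (Kwh z φ) {g} {h} g≗h w = ⟦Kwh⟧-cong L (λ d → ⟦⟧-coincide φ (agree d)) w
    where
    agree : ∀ d u → Free u φ → (g [ z ≔ d ]) u ≡ (h [ z ≔ d ]) u
    agree d u u∈φ with u ≟ℕ z
    ... | yes _   = refl
    ... | no  u≢z = g≗h u (free-Kwh (u≢z ∘ sym) u∈φ)

  ⟦⟧-fresh : ∀ φ {x} → ¬ Free x φ → ∀ g a w → ⟦ φ ⟧ w (g [ x ≔ a ]) ≡ ⟦ φ ⟧ w g
  ⟦⟧-fresh φ x∉φ g a = ⟦⟧-coincide φ λ u u∈φ → ≔-other g a λ { refl → x∉φ u∈φ }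

  ⟦⟧-sub : ∀ {y x} φ → FreeFor y x φ → ∀ w g → ⟦ sub y x φ ⟧ w g ≡ ⟦ φ ⟧ w (g [ x ≔ g y ])
  ⟦⟧-sub {y} {x} (atom P ys) _ w g =
    cong (I P w) (trans (sym (map-∘ g (rename {S = S} y x) ys)) (map-cong (rename-≔ g y x) ys))
  ⟦⟧-sub (~ φ)   (ff-~ ff)     w g = cong not (⟦⟧-sub φ ff w g)
  ⟦⟧-sub (φ & ψ) (ff-& ff ff′) w g = cong₂ _∧_ (⟦⟧-sub φ ff w g) (⟦⟧-sub ψ ff′ w g)
  ⟦⟧-sub (K φ)   (ff-K ff)     w g = □-cong (λ v → ⟦⟧-sub φ ff v g) w
  ⟦⟧-sub {y} (Kwh z φ) (ff-Kwh-nofree x∉) w g =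
    trans (cong (λ χ → ⟦ χ ⟧ w g) (sub-fresh (Kwh z φ) x∉)) (sym (⟦⟧-fresh (Kwh z φ) x∉ g (g y) w))
  ⟦⟧-sub {y} {x} (Kwh z φ) (ff-Kwh z≢y ff) w g with z ≟ℕ x
  ... | yes z≡x = sym (⟦⟧-fresh (Kwh z φ) (λ { (free-Kwh z≢x _) → z≢x z≡x }) g (g y) w)
  ... | no  z≢x = ⟦Kwh⟧-cong L (λ d v → trans (⟦⟧-sub φ ff v (g [ z ≔ d ]))
                                              (⟦⟧-coincide φ (λ u _ → swap d u) v)) w
    where
    swap : ∀ d u → ((g [ z ≔ d ]) [ x ≔ (g [ z ≔ d ]) y ]) u ≡ ((g [ x ≔ g y ]) [ z ≔ d ]) u
    swap d u = trans (cong (λ a → ((g [ z ≔ d ]) [ x ≔ a ]) u) (≔-other g d (z≢y ∘ sym)))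
                     (≔-comm g (g y) d (z≢x ∘ sym) u)

  -- The semantic side condition under which the context rules
  -- (K_wh toTB, K_wh toK, FS&BtoK_wh, FS&KtoK_wh) preserve validity.
  record Entails∀ (x : Var) (χ χ′ : Fm S) : Set where
    constructor entails∀
    field holds : ∀ w g → (∀ d → T (⟦ χ ⟧ w (g [ x ≔ d ]))) → T (⟦ χ′ ⟧ w g)
  open Entails∀

  Entails∀-⇒ : ∀ {x ψ χ χ′} → ¬ Free x ψ → Entails∀ x χ χ′ → Entails∀ x (ψ ⇒ χ) (ψ ⇒ χ′)
  Entails∀-⇒ {ψ = ψ} x∉ψ e = entails∀ λ w g ψ⇒χ → T-⇒ᵇ⁺ λ ψ-holds → holds e w g λ d →
    T-⇒ᵇ⁻ (ψ⇒χ d) (subst T (sym (⟦⟧-fresh ψ x∉ψ g d w)) ψ-holds)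

  Entails∀-K : ∀ {x χ χ′} → Entails∀ x χ χ′ → Entails∀ x (K χ) (K χ′)
  Entails∀-K e = entails∀ λ w g □χ → □-intro λ {v} w≼v → holds e v g λ d → □-elim (□χ d) w≼v

  Entails∀-nest : ∀ {x χ χ′} ψs → All (λ ψ → ¬ Free x ψ) ψs →
                  Entails∀ x χ χ′ → Entails∀ x (nest ψs χ) (nest ψs χ′)
  Entails∀-nest []       []           e = e
  Entails∀-nest (ψ ∷ ψs) (x∉ψ ∷ x∉ψs) e = Entails∀-K (Entails∀-⇒ x∉ψ (Entails∀-nest ψs x∉ψs e))

  ⊨-Ctx : ∀ {x ψ₀ ψs χ χ′} → CtxFresh x ψ₀ ψs → Entails∀ x χ χ′ →
          ⊨ Ctx ψ₀ ψs χ → ⊨ Ctx ψ₀ ψs χ′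
  ⊨-Ctx {x} {ψs = ψs} (x∉ψ₀ , x∉ψs) e ⊨C w g =
    holds (Entails∀-⇒ x∉ψ₀ (Entails∀-nest ψs x∉ψs e)) w g λ d → ⊨C w (g [ x ≔ d ])

  sound : ∀ {φ} → L ⊢ φ → ⊨ φ
  sound (taut {φ = φ} t) w g = from T-≡ (trans (sym (⟦⟧-evalB φ w g)) (t _))
  sound axK w g = T-⇒ᵇ⁺ λ □φ⇒ψ → T-⇒ᵇ⁺ λ □φ → □-intro λ w≼v →
    T-⇒ᵇ⁻ (□-elim □φ⇒ψ w≼v) (□-elim □φ w≼v)
  sound axT w g = T-⇒ᵇ⁺ λ □φ → □-elim □φ ≼-refl
  sound ax4 w g = T-⇒ᵇ⁺ λ □φ → □-intro λ w≼v → □-intro λ v≼u → □-elim □φ (≼-trans w≼v v≼u)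
  sound ax2 w g = T-⇒ᵇ⁺ λ ◇□φ → □-intro λ {v} _ → ◇-intro (≼-top v) (◇□-elim ◇□φ)
  sound (mp p q) w g = T-⇒ᵇ⁻ (sound p w g) (sound q w g)
  sound (nec p) w g = □-intro λ {v} _ → sound p v g
  sound (TBtoKwh {y = y} ff) w g = T-⇒ᵇ⁺ λ h →
    let Bφ , φ-holds = to T-∧ (subst T (⟦⟧-sub _ ff w g) h) in tB-some-intro (g y) Bφ φ-holds
  sound (KtoKwh {y = y} ff) w g = T-⇒ᵇ⁺ λ h →
    K-some-intro (g y) (subst T (⟦⟧-sub _ (ff-K ff) w g) h)
  sound (KwhtoFS {y = y} fs ff) w g = T-⇒ᵇ⁺ λ h →
    subst T (sym (⟦⟧-sub _ ff w g)) (T-⇒ᵇ⁺ (⟦Kwh⟧-FS fs h (g y)))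
  sound (BtoBKwh {y = y} fs ff) w g = T-⇒ᵇ⁺ λ h →
    ◇□-intro (⟦Kwh⟧-top (g y) fs (◇□-elim (subst T (⟦⟧-sub _ (ff-B ff) w g) h)))
  sound (KwhtoTB tb fr p) = ⊨-Ctx fr (entails∀ λ w g ¬Bφ∧φ → T-not⁺ λ h →
    let d , Bφ , φ-holds = ⟦Kwh⟧-tB tb h in T-not⁻ (¬Bφ∧φ d) (from T-∧ (Bφ , φ-holds))) (sound p)
  sound (KwhtoK k fr p) = ⊨-Ctx fr (entails∀ λ w g ¬Kφ → T-not⁺ λ h →
    let d , Kφ = ⟦Kwh⟧-K k h in T-not⁻ (¬Kφ d) Kφ) (sound p)
  sound (FSBtoKwh {y = y} fr ff p) = ⊨-Ctx fr (entails∀ λ w g FS → T-⇒ᵇ⁺ λ h →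
    ⟦Kwh⟧-FS&B (g y) (subst T (⟦⟧-sub _ (ff-B ff) w g) h) (λ d → T-⇒ᵇ⁻ (FS d))) (sound p)
  sound (FSKtoKwh {y = y} fr ff p) = ⊨-Ctx fr (entails∀ λ w g FS → T-⇒ᵇ⁺ λ h →
    ⟦Kwh⟧-FS&K (g y) (subst T (⟦⟧-sub _ (ff-K ff) w g) h) (λ d → T-⇒ᵇ⁻ (FS d))) (sound p)

module _ {S : Signature} {L : Variant} where

  ⊢-⇒-trans : ∀ {A B C : Fm S} → L ⊢ A ⇒ B → L ⊢ B ⇒ C → L ⊢ A ⇒ C
  ⊢-⇒-trans {A} {B} {C} A⇒B B⇒C =
    mp (mp (taut λ v → chain (evalB v A) (evalB v B) (evalB v C)) A⇒B) B⇒C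
    where
    chain : ∀ a b c → ((a ⇒ᵇ b) ⇒ᵇ (b ⇒ᵇ c) ⇒ᵇ a ⇒ᵇ c) ≡ true
    chain true  true  true  = refl
    chain true  true  false = refl
    chain true  false _     = refl
    chain false true  true  = refl
    chain false true  false = refl
    chain false false _     = refl

  ⊢-contraposition : ∀ {A B : Fm S} → L ⊢ A ⇒ B → L ⊢ ~ B ⇒ ~ A
  ⊢-contraposition {A} {B} = mp (taut λ v → contra (evalB v A) (evalB v B))
    where
    contra : ∀ a b → ((a ⇒ᵇ b) ⇒ᵇ not b ⇒ᵇ not a) ≡ true
    contra true  true  = refl
    contra true  false = refl
    contra false true  = refl
    contra false false = refl

  ⊢-contraposition⁻ : ∀ {A B : Fm S} → L ⊢ ~ B ⇒ ~ A → L ⊢ A ⇒ B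
  ⊢-contraposition⁻ {A} {B} = mp (taut λ v → contra⁻ (evalB v A) (evalB v B))
    where
    contra⁻ : ∀ a b → ((not b ⇒ᵇ not a) ⇒ᵇ a ⇒ᵇ b) ≡ true
    contra⁻ true  true  = refl
    contra⁻ true  false = refl
    contra⁻ false true  = refl
    contra⁻ false false = refl

K-MS⊢Kwh⇒KKwh : ∀ {S} (φ : Fm S) x → K-MS ⊢ Kwh x φ ⇒ K (Kwh x φ)
K-MS⊢Kwh⇒KKwh φ x = ⊢-contraposition⁻ ¬KKwh⇒¬Kwh
  where
  Kφ⇒Kwh : K-MS ⊢ K φ ⇒ Kwh x φ
  Kφ⇒Kwh = subst (λ ψ → K-MS ⊢ K ψ ⇒ Kwh x φ) (sub-refl x φ) (KtoKwh (freeFor-refl x φ))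

  Kφ⇒KKwh : K-MS ⊢ K φ ⇒ K (Kwh x φ)
  Kφ⇒KKwh = ⊢-⇒-trans ax4 (mp axK (nec Kφ⇒Kwh))

  x∉KKwh : ¬ Free x (~ K (Kwh x φ))
  x∉KKwh (free-~ (free-K (free-Kwh x≢x _))) = x≢x refl

  ¬KKwh⇒¬Kwh : K-MS ⊢ ~ K (Kwh x φ) ⇒ ~ Kwh x φ
  ¬KKwh⇒¬Kwh = KwhtoK {ψs = []} k₁ (x∉KKwh , []) (⊢-contraposition Kφ⇒KKwh)

-- The countermodel

off-w₁ : World → Bool
off-w₁ w₁ = false
off-w₁ _  = true

P-ext : Variant → Extension
P-ext K-MS-FS d w = d ∨ off-w₁ w
P-ext _       _ w = off-w₁ w

onFirst : ∀ {n} → (Bool → Bool) → Vec Bool n → Bool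
onFirst p []      = true
onFirst p (d ∷ _) = p d

onFirst-replicate : ∀ {n} → 1 ≤ n → ∀ p (g : Assignment) x → onFirst p (map g (replicate n x)) ≡ p (g x)
onFirst-replicate (s≤s _) p g x = refl

countermodel : ∀ {S} → Variant → Interpretation S
countermodel L P w = onFirst λ d → P-ext L d w

opaque
  unfolding □ tB-some K-some FS-all

  P-ext-Kwh-w₀ : ∀ {L} → L ≢ K-MS → T (⟦Kwh⟧ L (P-ext L) w₀)
  P-ext-Kwh-w₀ {tB-MS}    _       = tt
  P-ext-Kwh-w₀ {tB-MS-FS} _       = tt
  P-ext-Kwh-w₀ {K-MS}     L≢K-MS = L≢K-MS refl
  P-ext-Kwh-w₀ {K-MS-FS}  _       = tt

  P-ext-¬Kwh-w₁ : ∀ L → ¬ T (⟦Kwh⟧ L (P-ext L) w₁)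
  P-ext-¬Kwh-w₁ tB-MS    ()
  P-ext-¬Kwh-w₁ tB-MS-FS ()
  P-ext-¬Kwh-w₁ K-MS     ()
  P-ext-¬Kwh-w₁ K-MS-FS  ()

diagonal-atom : ∀ {S} → Pred S → Var → Fm S
diagonal-atom {S} P x = atom P (replicate (arity S P) x)

⊬Kwh⇒KKwh : ∀ {S L} → L ≢ K-MS → (P : Pred S) → 1 ≤ arity S P →
            ¬ (L ⊢ Kwh 0 (diagonal-atom P 0) ⇒ K (Kwh 0 (diagonal-atom P 0)))
⊬Kwh⇒KKwh {S} {L} L≢K-MS P 1≤n ⊢Kwh⇒KKwh =
  P-ext-¬Kwh-w₁ L (□-elim (T-⇒ᵇ⁻ valid-at-w₀ (P-ext-Kwh-w₀ L≢K-MS)) w₀≼w₁)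
  where
  open Semantics L (countermodel {S} L)

  g : Assignment
  g _ = true

  ext≗P-ext : ∀ d w → ⟦ diagonal-atom P 0 ⟧ w (g [ 0 ≔ d ]) ≡ P-ext L d w
  ext≗P-ext d w = trans (onFirst-replicate 1≤n (λ e → P-ext L e w) (g [ 0 ≔ d ]) 0)
                        (cong (λ e → P-ext L e w) (≔-same g 0 d))

  valid-at-w₀ : T (⟦Kwh⟧ L (P-ext L) w₀ ⇒ᵇ □ (⟦Kwh⟧ L (P-ext L)) w₀)
  valid-at-w₀ = subst T (cong₂ _⇒ᵇ_ (⟦Kwh⟧-cong L ext≗P-ext w₀) (□-cong (⟦Kwh⟧-cong L ext≗P-ext) w₀))
                        (sound ⊢Kwh⇒KKwh w₀ g)

proposition1 : (S : Signature) →
    (∀ (φ : Fm S) (x : Var) → K-MS ⊢ (Kwh x φ ⇒ K (Kwh x φ)))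
    × (∃ (λ (P : Pred S) → 1 ≤ arity S P) →
       ∀ (L : Variant) → L ≢ K-MS →
       ∃₂ λ (φ : Fm S) (x : Var) → ¬ (L ⊢ (Kwh x φ ⇒ K (Kwh x φ))))
proposition1 S = K-MS⊢Kwh⇒KKwh , λ { (P , 1≤n) L L≢K-MS →
  diagonal-atom {S} P 0 , 0 , ⊬Kwh⇒KKwh L≢K-MS P 1≤n }
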